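{- For any two non-trivial finite simple connected graphs $G$ and $H$, $$\gamma_{P}(G\,\square\,H)\leq \min\{Z(G)\,\gamma(H),\ Z(H)\,\gamma(G)\}.$$
   Context: Power domination: for $S\subseteq V(G)$, start with $M(S)=N[S]$ and repeatedly add a vertex $w$ whenever some $v\in M(S)$ has $w$ as its unique neighbour outside $M(S)$; $S$ is a power dominating set if the final $M(S)$ equals $V(G)$; $\gamma_P(G)$ is the minimum size of a power dominating set. Zero forcing: colour the vertices of $Z\subseteq V(G)$ black and the rest white; repeatedly, if a black vertex has exactly one white neighbour, that neighbour becomes black; $Z$ is a zero forcing set if eventually all vertices are black, and $Z(G)$ is the minimum size of a zero forcing set. $\gamma(G)$ is the domination number. The Cartesian product $G\,\square\,H$ has vertex set $V(G)\times V(H)$, with $(a,b)\sim(x,y)$ iff either $a=x$ and $by\in E(H)$, or $b=y$ and $ax\in E(G)$. -}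

module Defs where

open import Level using (0ℓ)
open import Data.Nat using (ℕ; _≤_; _*_; _⊓_)
open import Data.Fin using (Fin; remQuot)
open import Data.Fin.Subset using (Subset; _∈_; _∉_; _∪_; ⁅_⁆; ∣_∣; ⊤)
open import Data.Product using (Σ; _×_; _,_; proj₁; proj₂; ∃; ∃-syntax)
open import Data.Sum using (_⊎_; inj₁; inj₂)
open import Relation.Nullary using (¬_)
open import Relation.Binary using (Rel)
open import Relation.Binary.PropositionalEquality as Eq using (_≡_)
open import Relation.Binary.Construct.Closure.ReflexiveTransitive using (Star)

record Graph (n : ℕ) : Set₁ where
  field
    Adj       : Rel (Fin n) 0ℓ
    sym       : ∀ {u v} → Adj u v → Adj v u
    irrefl    : ∀ {u} → ¬ Adj u u
open Graph public

module _ {n : ℕ} (G : Graph n) where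

  Connected : Set
  Connected = ∀ (u v : Fin n) → Star (Adj G) u v

  Dominating : Subset n → Set
  Dominating S = ∀ v → v ∈ S ⊎ ∃[ u ] (u ∈ S × Adj G u v)

  IsClosedNbhd : Subset n → Subset n → Set
  IsClosedNbhd S T = ∀ v → (v ∈ T → (v ∈ S ⊎ ∃[ u ] (u ∈ S × Adj G u v)))
                         × ((v ∈ S ⊎ ∃[ u ] (u ∈ S × Adj G u v)) → v ∈ T)

  ForceStep : Subset n → Subset n → Set
  ForceStep B B' = ∃[ v ] ∃[ w ] (v ∈ B × Adj G v w × w ∉ B
                     × (∀ u → Adj G v u → u ∉ B → u ≡ w)
                     × B' ≡ B ∪ ⁅ w ⁆)

  ZeroForcing : Subset n → Set
  ZeroForcing Z = Star ForceStep Z ⊤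

  PowerDominating : Subset n → Set
  PowerDominating S = ∃[ T ] (IsClosedNbhd S T × Star ForceStep T ⊤)

IsMinSize : {n : ℕ} → (Subset n → Set) → ℕ → Set
IsMinSize P k = (∃[ S ] (P S × ∣ S ∣ ≡ k)) × (∀ S → P S → k ≤ ∣ S ∣)

IsDominationNumber : {n : ℕ} → Graph n → ℕ → Set
IsDominationNumber G = IsMinSize (Dominating G)

IsZeroForcingNumber : {n : ℕ} → Graph n → ℕ → Set
IsZeroForcingNumber G = IsMinSize (ZeroForcing G)

IsPowerDominationNumber : {n : ℕ} → Graph n → ℕ → Set
IsPowerDominationNumber G = IsMinSize (PowerDominating G)

-- Cartesian product G □ H on Fin (n * m); vertex i corresponds to remQuot m i.
CartAdj : {n m : ℕ} → Graph n → Graph m → Rel (Fin (n * m)) 0ℓ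
CartAdj {n} {m} G H i j =
    (proj₁ (remQuot {n} m i) ≡ proj₁ (remQuot {n} m j) × Adj H (proj₂ (remQuot {n} m i)) (proj₂ (remQuot {n} m j)))
  ⊎ (proj₂ (remQuot {n} m i) ≡ proj₂ (remQuot {n} m j) × Adj G (proj₁ (remQuot {n} m i)) (proj₁ (remQuot {n} m j)))

private
  cart-sym : {n m : ℕ} (G : Graph n) (H : Graph m) → ∀ {i j} → CartAdj G H i j → CartAdj G H j i
  cart-sym G H (inj₁ (e , q)) = inj₁ (Eq.sym e , Graph.sym H q)
  cart-sym G H (inj₂ (e , q)) = inj₂ (Eq.sym e , Graph.sym G q)

  cart-irrefl : {n m : ℕ} (G : Graph n) (H : Graph m) → ∀ {i} → ¬ CartAdj G H i i
  cart-irrefl G H (inj₁ (_ , q)) = Graph.irrefl H q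
  cart-irrefl G H (inj₂ (_ , q)) = Graph.irrefl G q

_□_ : {n m : ℕ} → Graph n → Graph m → Graph (n * m)
G □ H = record { Adj = CartAdj G H ; sym = cart-sym G H ; irrefl = cart-irrefl G H }

{-# OPTIONS --safe #-}
-- If Z zero forces G and D dominates H, then Z × D power dominates G □ H.
-- Its closed neighbourhood contains the whole cylinder Z × V(H), and every
-- force v → w of G lifts to the forces (v , y) → (w , y), one for each
-- vertex y of H: the other neighbours (v , y′) of (v , y) already lie in the
-- cylinder. Taking Z and D of minimum size gives γP(G □ H) ≤ Z(G) γ(H), and
-- the other bound follows by exchanging the roles of G and H.
module Submission where

open import Defs hiding (sym)
open import Data.Bool using (if_then_else_)
open import Data.Bool.Properties using (T-≡)
open import Data.Empty using (⊥-elim)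
open import Data.Fin using (Fin; remQuot; combine)
open import Data.Fin.Properties using (any?; all?; ¬∀⟶∃¬; remQuot-combine; combine-remQuot; sequence)
import Data.Fin.Properties as Fin
open import Data.Fin.Subset using (Subset; _∈_; _∉_; _∪_; ⁅_⁆; ∣_∣; ⊤; ⊥; _⊆_; inside; outside)
open import Data.Fin.Subset.Properties
  using (_∈?_; ∈⊤; ⊆⊤; ⊆-antisym; x∈⁅y⁆⇒x≡y; x∈⁅x⁆; x∈p∪q⁻; x∈p∪q⁺; p⊆p∪q; ∣p∣≤n; p⊂q⇒∣p∣<∣q∣; ∣⊥∣≡0)
open import Data.Nat using (ℕ; zero; suc; _+_; _*_; _⊓_; _≤_; _≤?_)
open import Data.Nat.Properties using (⊓-glb; ≤-trans; ≤-reflexive; +-suc; +-monoʳ-≤; m≤m+n; n≮n; *-comm)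
open import Data.Product using (_×_; _,_; proj₁; proj₂; ∃-syntax)
open import Data.Sum using (_⊎_; inj₁; inj₂; [_,_]; swap)
import Data.Sum as Sum
open import Data.Vec using (_∷_; []; _++_; concat; map; lookup; tabulate)
open import Data.Vec.Properties using (lookup∘tabulate; []=⇒lookup; lookup⇒[]=; lookup-concat; lookup-map)
open import Effect.Monad using (RawMonad)
open import Function using (_∘_; id; Equivalence)
open import Relation.Binary.Definitions using (Decidable)
open import Relation.Binary.PropositionalEquality using (_≡_; refl; sym; trans; cong; cong₂; subst; subst₂; module ≡-Reasoning)
open import Relation.Binary.Construct.Closure.ReflexiveTransitive using (Star; ε; _◅_)
open import Relation.Nullary using (¬_; yes; no)
open import Relation.Nullary.Decidable using (decidable-stable; isYes; toWitness; fromWitness; _⊎-dec_; _×-dec_)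
open import Relation.Nullary.Negation using (¬¬-Monad)
open import Relation.Nullary.Decidable.Core using (¬¬-excluded-middle)
import Relation.Unary as U

-- Adjacency is an arbitrary relation, hence only ¬¬-decidable; this suffices
-- because the inequality to be proved is itself decidable.
¬¬-decidableAdj : ∀ {n} (G : Graph n) → ¬ ¬ Decidable (Adj G)
¬¬-decidableAdj G = ¬¬-sequence λ x → ¬¬-sequence λ y → ¬¬-excluded-middle
  where ¬¬-sequence = sequence (RawMonad.rawApplicative ¬¬-Monad)

module _ {N : ℕ} {ℓ} {P : U.Pred (Fin N) ℓ} (P? : U.Decidable P) where

  subset : Subset N
  subset = tabulate (isYes ∘ P?)

  ∈-subset⁺ : ∀ {i} → P i → i ∈ subset
  ∈-subset⁺ {i} p = lookup⇒[]= i subset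
    (trans (lookup∘tabulate (isYes ∘ P?) i) (Equivalence.to T-≡ (fromWitness {a? = P? i} p)))

  ∈-subset⁻ : ∀ {i} → i ∈ subset → P i
  ∈-subset⁻ {i} i∈ = toWitness {a? = P? i}
    (Equivalence.from T-≡ (trans (sym (lookup∘tabulate (isYes ∘ P?) i)) ([]=⇒lookup i∈)))

module Forcing {N : ℕ} (K : Graph N) where

  ForcesAll : Subset N → Set
  ForcesAll B = Star (ForceStep K) B ⊤

  forcesAll-mono : ∀ {B B′} → B ⊆ B′ → ForcesAll B → ForcesAll B′
  forcesAll-mono B⊆B′ ε = subst ForcesAll (sym (⊆-antisym ⊆⊤ B⊆B′)) ε
  forcesAll-mono {B} {B′} B⊆B′ ((v , w , v∈B , v~w , w∉B , unique , refl) ◅ forces) with w ∈? B′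
  ... | yes w∈B′ = forcesAll-mono (λ x∈ → [ B⊆B′ , (λ x∈⁅w⁆ → subst (_∈ B′) (sym (x∈⁅y⁆⇒x≡y w x∈⁅w⁆)) w∈B′) ]
                                             (x∈p∪q⁻ B ⁅ w ⁆ x∈)) forces
  ... | no w∉B′  = (v , w , B⊆B′ v∈B , v~w , w∉B′ , (λ u v~u u∉B′ → unique u v~u (u∉B′ ∘ B⊆B′)) , refl)
                   ◅ forcesAll-mono (x∈p∪q⁺ ∘ Sum.map₁ B⊆B′ ∘ x∈p∪q⁻ B ⁅ w ⁆) forces

  forceStep-grows : ∀ {B B′} → ForceStep K B B′ → suc ∣ B ∣ ≤ ∣ B′ ∣
  forceStep-grows {B} (_ , w , _ , _ , w∉B , _ , refl) =
    p⊂q⇒∣p∣<∣q∣ (p⊆p∪q ⁅ w ⁆ , w , x∈p∪q⁺ (inj₂ (x∈⁅x⁆ w)) , w∉B)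

  -- Forcing cannot get stuck while the invariant Q holds, and each force
  -- enlarges the coloured set, so at most N forces are needed.
  module _ (Q : Subset N → Set)
           (progress : ∀ B → Q B → ForcesAll B ⊎ ∃[ B′ ] (ForceStep K B B′ × Q B′)) where

    forcesAll-within : ∀ k B → N ≤ k + ∣ B ∣ → Q B → ForcesAll B
    forcesAll-within k B bound q with progress B q
    ... | inj₁ done = done
    forcesAll-within zero B bound q | inj₂ (B′ , step , _) =
      ⊥-elim (n≮n ∣ B ∣ (≤-trans (forceStep-grows step) (≤-trans (∣p∣≤n B′) bound)))
    forcesAll-within (suc k) B bound q | inj₂ (B′ , step , q′) =
      step ◅ forcesAll-within k B′ (≤-trans bound (≤-trans (≤-reflexive (sym (+-suc k ∣ B ∣)))
                                                          (+-monoʳ-≤ k (forceStep-grows step)))) q′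

    forcesAll-invariant : ∀ B → Q B → ForcesAll B
    forcesAll-invariant B = forcesAll-within N B (m≤m+n N ∣ B ∣)

  closedNbhd : Decidable (Adj K) → ∀ S → ∃[ T ] IsClosedNbhd K S T
  closedNbhd K? S = subset dominated? , λ v → ∈-subset⁻ dominated? , ∈-subset⁺ dominated?
    where
    dominated? : U.Decidable (λ v → v ∈ S ⊎ ∃[ u ] (u ∈ S × Adj K u v))
    dominated? v = (v ∈? S) ⊎-dec any? (λ u → (u ∈? S) ×-dec K? u v)

record IsCartesianProduct {N a b : ℕ} (K : Graph N) (G : Graph a) (H : Graph b) : Set where
  field
    fst          : Fin N → Fin a
    snd          : Fin N → Fin b
    pair         : Fin a → Fin b → Fin N
    fst-pair     : ∀ x y → fst (pair x y) ≡ x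
    snd-pair     : ∀ x y → snd (pair x y) ≡ y
    pair-fst-snd : ∀ i → pair (fst i) (snd i) ≡ i
    adj⁻         : ∀ {i j} → Adj K i j →
                   (fst i ≡ fst j × Adj H (snd i) (snd j)) ⊎ (snd i ≡ snd j × Adj G (fst i) (fst j))
    adj⁺         : ∀ {i j} →
                   (fst i ≡ fst j × Adj H (snd i) (snd j)) ⊎ (snd i ≡ snd j × Adj G (fst i) (fst j)) →
                   Adj K i j

  ≡-pair : ∀ {i x y} → fst i ≡ x → snd i ≡ y → i ≡ pair x y
  ≡-pair {i} fst≡x snd≡y = trans (sym (pair-fst-snd i)) (cong₂ pair fst≡x snd≡y)

  adj-pairˡ : ∀ {x x′} y → Adj G x x′ → Adj K (pair x y) (pair x′ y)
  adj-pairˡ {x} {x′} y x~x′ =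
    adj⁺ (inj₂ ( trans (snd-pair x y) (sym (snd-pair x′ y))
               , subst₂ (Adj G) (sym (fst-pair x y)) (sym (fst-pair x′ y)) x~x′))

module CylinderForcing {N a b : ℕ} {K : Graph N} {G : Graph a} {H : Graph b}
                       (K-product : IsCartesianProduct K G H) where

  open IsCartesianProduct K-product
  open Forcing K

  cylinder : Subset a → Subset N
  cylinder B = subset (λ i → fst i ∈? B)

  ∈-cylinder⁺ : ∀ {B i} → fst i ∈ B → i ∈ cylinder B
  ∈-cylinder⁺ {B} = ∈-subset⁺ (λ i → fst i ∈? B)

  ∈-cylinder⁻ : ∀ {B i} → i ∈ cylinder B → fst i ∈ B
  ∈-cylinder⁻ {B} = ∈-subset⁻ (λ i → fst i ∈? B)

  pair-∈-cylinder : ∀ {B x} y → x ∈ B → pair x y ∈ cylinder B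
  pair-∈-cylinder {B} y x∈B = ∈-cylinder⁺ (subst (_∈ B) (sym (fst-pair _ y)) x∈B)

  -- The neighbours (v , y′) of (v , y) lie in the cylinder over B, and of the
  -- neighbours (u , y) only (w , y) can be uncoloured.
  lifted-forceStep : ∀ {B C v w} → v ∈ B → Adj G v w → (∀ u → Adj G v u → u ∉ B → u ≡ w) →
                     cylinder B ⊆ C → ∀ y → pair w y ∉ C → ForceStep K C (C ∪ ⁅ pair w y ⁆)
  lifted-forceStep {B} {C} {v} {w} v∈B v~w unique cylB⊆C y wy∉C =
    pair v y , pair w y , cylB⊆C (pair-∈-cylinder y v∈B) , adj-pairˡ y v~w , wy∉C , unique′ , refl
    where
    unique′ : ∀ u → Adj K (pair v y) u → u ∉ C → u ≡ pair w y
    unique′ u vy~u u∉C with adj⁻ vy~u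
    ... | inj₁ (same-fst , _) =
      ⊥-elim (u∉C (cylB⊆C (∈-cylinder⁺ (subst (_∈ B) (trans (sym (fst-pair v y)) same-fst) v∈B))))
    ... | inj₂ (same-snd , v~u) =
      ≡-pair (unique (fst u) (subst (λ t → Adj G t (fst u)) (fst-pair v y) v~u) (u∉C ∘ cylB⊆C ∘ ∈-cylinder⁺))
             (trans (sym same-snd) (snd-pair v y))

  cylinder-∪-⊆ : ∀ {B C w} → cylinder B ⊆ C → (∀ y → pair w y ∈ C) → cylinder (B ∪ ⁅ w ⁆) ⊆ C
  cylinder-∪-⊆ {B} {C} {w} cylB⊆C fibre⊆C {i} i∈ with x∈p∪q⁻ B ⁅ w ⁆ (∈-cylinder⁻ i∈)
  ... | inj₁ fst∈B   = cylB⊆C (∈-cylinder⁺ fst∈B)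
  ... | inj₂ fst∈⁅w⁆ = subst (_∈ C) (sym (≡-pair (x∈⁅y⁆⇒x≡y w fst∈⁅w⁆) refl)) (fibre⊆C (snd i))

  -- The forces (v , y) → (w , y) may interleave arbitrarily with forces
  -- made elsewhere, so we only track that the cylinder over B stays coloured.
  cylinder-forcesAll-step : ∀ {B B′} → ForceStep G B B′ → ForcesAll (cylinder B′) → ForcesAll (cylinder B)
  cylinder-forcesAll-step {B} (v , w , v∈B , v~w , _ , unique , refl) forces =
    forcesAll-invariant (cylinder B ⊆_) progress (cylinder B) id
    where
    progress : ∀ C → cylinder B ⊆ C → ForcesAll C ⊎ ∃[ C′ ] (ForceStep K C C′ × cylinder B ⊆ C′)
    progress C cylB⊆C with all? (λ y → pair w y ∈? C)
    ... | yes fibre⊆C = inj₁ (forcesAll-mono (cylinder-∪-⊆ cylB⊆C fibre⊆C) forces)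
    ... | no fibre⊈C with ¬∀⟶∃¬ _ _ (λ y → pair w y ∈? C) fibre⊈C
    ...   | y , wy∉C = inj₂ (_ , lifted-forceStep v∈B v~w unique cylB⊆C y wy∉C , p⊆p∪q _ ∘ cylB⊆C)

  cylinder-forcesAll : ∀ {Z} → ZeroForcing G Z → ForcesAll (cylinder Z)
  cylinder-forcesAll ε                = forcesAll-mono (λ _ → ∈-cylinder⁺ ∈⊤) ε
  cylinder-forcesAll (step ◅ forces) = cylinder-forcesAll-step step (cylinder-forcesAll forces)

  zeroForcing×dominating⇒powerDominating :
    Decidable (Adj K) → ∀ {Z D S} → ZeroForcing G Z → Dominating H D →
    (∀ {x y} → x ∈ Z → y ∈ D → pair x y ∈ S) → PowerDominating K S
  zeroForcing×dominating⇒powerDominating K? {Z} {D} {S} zf dom Z×D⊆S =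
    T , T-nbhd , forcesAll-mono cylZ⊆T (cylinder-forcesAll zf)
    where
    T = proj₁ (closedNbhd K? S)
    T-nbhd = proj₂ (closedNbhd K? S)
    dominated : ∀ i → fst i ∈ Z → i ∈ S ⊎ ∃[ u ] (u ∈ S × Adj K u i)
    dominated i fst∈Z with dom (snd i)
    ... | inj₁ snd∈D = inj₁ (subst (_∈ S) (pair-fst-snd i) (Z×D⊆S fst∈Z snd∈D))
    ... | inj₂ (y , y∈D , y~snd) =
      inj₂ (pair (fst i) y , Z×D⊆S fst∈Z y∈D ,
            adj⁺ (inj₁ (fst-pair _ y , subst (λ t → Adj H t (snd i)) (sym (snd-pair _ y)) y~snd)))
    cylZ⊆T : cylinder Z ⊆ T
    cylZ⊆T {i} i∈ = proj₂ (T-nbhd i) (dominated i (∈-cylinder⁻ i∈))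

_×ˢ_ : ∀ {n m} → Subset n → Subset m → Subset (n * m)
A ×ˢ B = concat (map (λ a → if a then B else ⊥) A)

∣p++q∣≡∣p∣+∣q∣ : ∀ {n m} (p : Subset n) (q : Subset m) → ∣ p ++ q ∣ ≡ ∣ p ∣ + ∣ q ∣
∣p++q∣≡∣p∣+∣q∣ []            q = refl
∣p++q∣≡∣p∣+∣q∣ (inside ∷ p)  q = cong suc (∣p++q∣≡∣p∣+∣q∣ p q)
∣p++q∣≡∣p∣+∣q∣ (outside ∷ p) q = ∣p++q∣≡∣p∣+∣q∣ p q

∣p×ˢq∣≡∣p∣*∣q∣ : ∀ {n m} (p : Subset n) (q : Subset m) → ∣ p ×ˢ q ∣ ≡ ∣ p ∣ * ∣ q ∣
∣p×ˢq∣≡∣p∣*∣q∣ []            q = refl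
∣p×ˢq∣≡∣p∣*∣q∣ (inside ∷ p)  q = trans (∣p++q∣≡∣p∣+∣q∣ q (p ×ˢ q)) (cong (∣ q ∣ +_) (∣p×ˢq∣≡∣p∣*∣q∣ p q))
∣p×ˢq∣≡∣p∣*∣q∣ {m = m} (outside ∷ p) q =
  trans (∣p++q∣≡∣p∣+∣q∣ (⊥ {m}) (p ×ˢ q)) (cong₂ _+_ (∣⊥∣≡0 m) (∣p×ˢq∣≡∣p∣*∣q∣ p q))

combine-∈-×ˢ : ∀ {n m} {A : Subset n} {B : Subset m} {x y} → x ∈ A → y ∈ B → combine x y ∈ A ×ˢ B
combine-∈-×ˢ {A = A} {B} {x} {y} x∈A y∈B = lookup⇒[]= (combine x y) (A ×ˢ B) (begin
  lookup (A ×ˢ B) (combine x y)                            ≡⟨ lookup-concat (map row A) x y ⟩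
  lookup (lookup (map row A) x) y                          ≡⟨ cong (λ r → lookup r y) (lookup-map x row A) ⟩
  lookup (row (lookup A x)) y                              ≡⟨ cong (λ a → lookup (row a) y) ([]=⇒lookup x∈A) ⟩
  lookup B y                                               ≡⟨ []=⇒lookup y∈B ⟩
  inside                                                   ∎)
  where
  open ≡-Reasoning
  row = λ a → if a then B else ⊥

module _ {n m : ℕ} (G : Graph n) (H : Graph m) where

  □-isCartesianProduct : IsCartesianProduct (G □ H) G H
  □-isCartesianProduct = record
    { fst          = proj₁ ∘ remQuot {n} m
    ; snd          = proj₂ ∘ remQuot {n} m
    ; pair         = combine
    ; fst-pair     = λ x y → cong proj₁ (remQuot-combine x y)
    ; snd-pair     = λ x y → cong proj₂ (remQuot-combine x y)
    ; pair-fst-snd = combine-remQuot {n} m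
    ; adj⁻         = id
    ; adj⁺         = id
    }

  □-isCartesianProductᵀ : IsCartesianProduct (G □ H) H G
  □-isCartesianProductᵀ = record
    { fst          = proj₂ ∘ remQuot {n} m
    ; snd          = proj₁ ∘ remQuot {n} m
    ; pair         = λ y x → combine x y
    ; fst-pair     = λ y x → cong proj₂ (remQuot-combine x y)
    ; snd-pair     = λ y x → cong proj₁ (remQuot-combine x y)
    ; pair-fst-snd = combine-remQuot {n} m
    ; adj⁻         = swap
    ; adj⁺         = swap
    }

  □-decidable : Decidable (Adj G) → Decidable (Adj H) → Decidable (Adj (G □ H))
  □-decidable G? H? i j =
      ((proj₁ (remQuot {n} m i) Fin.≟ proj₁ (remQuot {n} m j)) ×-dec H? _ _)
    ⊎-dec ((proj₂ (remQuot {n} m i) Fin.≟ proj₂ (remQuot {n} m j)) ×-dec G? _ _)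

  module _ (G? : Decidable (Adj G)) (H? : Decidable (Adj H)) where

    zeroForcing×ˢdominating⇒powerDominating : ∀ {Z D} → ZeroForcing G Z → Dominating H D →
                                              PowerDominating (G □ H) (Z ×ˢ D)
    zeroForcing×ˢdominating⇒powerDominating zf dom =
      CylinderForcing.zeroForcing×dominating⇒powerDominating □-isCartesianProduct
        (□-decidable G? H?) zf dom combine-∈-×ˢ

    dominating×ˢzeroForcing⇒powerDominating : ∀ {D Z} → Dominating G D → ZeroForcing H Z →
                                              PowerDominating (G □ H) (D ×ˢ Z)
    dominating×ˢzeroForcing⇒powerDominating dom zf =
      CylinderForcing.zeroForcing×dominating⇒powerDominating □-isCartesianProductᵀ
        (□-decidable G? H?) zf dom (λ z∈Z d∈D → combine-∈-×ˢ d∈D z∈Z)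

corollary1 : ∀ {n m : ℕ} (G : Graph n) (H : Graph m)
    → 2 ≤ n → 2 ≤ m → Connected G → Connected H
    → ∀ {zG zH gG gH p : ℕ}
    → IsZeroForcingNumber G zG → IsZeroForcingNumber H zH
    → IsDominationNumber G gG → IsDominationNumber H gH
    → IsPowerDominationNumber (G □ H) p
    → p ≤ (zG * gH) ⊓ (zH * gG)
corollary1 G H _ _ _ _ {p = p} ((ZG , zfG , refl) , _) ((ZH , zfH , refl) , _)
                       ((DG , domG , refl) , _) ((DH , domH , refl) , _) (_ , minimal) =
  decidable-stable (_ ≤? _) λ ¬bound →
    ¬¬-decidableAdj G λ G? → ¬¬-decidableAdj H λ H? → ¬bound (⊓-glb (boundG G? H?) (boundH G? H?))
  where
  boundG : Decidable (Adj G) → Decidable (Adj H) → p ≤ ∣ ZG ∣ * ∣ DH ∣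
  boundG G? H? = subst (p ≤_) (∣p×ˢq∣≡∣p∣*∣q∣ ZG DH)
    (minimal _ (zeroForcing×ˢdominating⇒powerDominating G H G? H? zfG domH))
  boundH : Decidable (Adj G) → Decidable (Adj H) → p ≤ ∣ ZH ∣ * ∣ DG ∣
  boundH G? H? = subst (p ≤_) (trans (∣p×ˢq∣≡∣p∣*∣q∣ DG ZH) (*-comm ∣ DG ∣ ∣ ZH ∣))
    (minimal _ (dominating×ˢzeroForcing⇒powerDominating G H G? H? domG zfH))
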